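{- Let $m>2$ be an integer, $n=3m$, and let $a,b$ be integers with $a\not\equiv b\pmod 3$. Then the $n$-tuple $(a,b,a,\,a,b,a,\,\ldots,\,a,b,a)$ (block $(a,b,a)$ repeated $m$ times) does not represent an $m$-axial $3m$-polygon.
   Context: Let $V_n=\{v_k=e^{2\pi i k/n}: k=0,\dots,n-1\}\subset\mathbb{C}$. An $n$-polygon is a closed polygonal path visiting every point of $V_n$ exactly once (a Hamiltonian cycle on $V_n$ drawn with straight segments). An $n$-tuple $(e_1,\dots,e_n)$ with entries in $\{1,\dots,n-1\}$ represents the path starting at $v_0$ and moving successively to $v_{s_1},\dots,v_{s_n}$, where $s_k=e_1+\dots+e_k$ (indices mod $n$); it represents an $n$-polygon iff $n\nmid s_k$ for $1\le k\le n-1$ and $n\mid s_n$. A symmetry axis of an $n$-polygon is a line through $0$ such that reflection in it maps the polygon onto itself. An $m$-axial $3m$-polygon is a $3m$-polygon with exactly $m$ symmetry axes. -}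

module Defs where

open import Data.Nat as ℕ using (ℕ; zero; suc; _∸_)
open import Data.Integer as ℤ using (ℤ; +_; _-_)
open import Data.Integer.Divisibility using (_∣_)
open import Data.List using (List; []; _∷_; length; take; foldr; concat; replicate)
open import Data.List.Relation.Unary.All using (All)
open import Data.List.Relation.Unary.Unique.Propositional using (Unique)
open import Data.List.Membership.Propositional using (_∈_)
open import Data.Product using (_×_; ∃)
open import Data.Sum using (_⊎_)
open import Relation.Nullary using (¬_)
open import Relation.Binary.PropositionalEquality using (_≡_)

_≡[_]_ : ℤ → ℕ → ℤ → Set
x ≡[ n ] y = (+ n) ∣ (x - y)

psum : List ℤ → ℕ → ℤ
psum e k = foldr ℤ._+_ (+ 0) (take k e)

Represents : ℕ → List ℤ → Set
Represents n e =
  length e ≡ n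
  × All (λ x → (+ 1 ℤ.≤ x) × (x ℤ.≤ + (n ∸ 1))) e
  × (∀ k → 1 ℕ.≤ k → k ℕ.≤ n ∸ 1 → ¬ ((+ n) ∣ psum e k))
  × ((+ n) ∣ psum e n)

SameEdge : ℕ → ℤ → ℤ → ℤ → ℤ → Set
SameEdge n x y x' y' =
  ((x ≡[ n ] x') × (y ≡[ n ] y')) ⊎ ((x ≡[ n ] y') × (y ≡[ n ] x'))

-- The reflections of the plane in lines through 0 mapping V_n to itself are
-- exactly v_k ↦ v_{j-k}, j = 0,...,n-1 (distinct j give distinct lines).
-- The k-th edge (k = 0,...,n-1) of the path joins v_{s_k} and v_{s_{k+1}}.
IsAxis : ℕ → List ℤ → ℕ → Set
IsAxis n e j =
  (∀ k → k ℕ.< n → ∃ λ k' → (k' ℕ.< n) ×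
      SameEdge n (+ j - psum e k) (+ j - psum e (suc k)) (psum e k') (psum e (suc k')))
  × (∀ k' → k' ℕ.< n → ∃ λ k → (k ℕ.< n) ×
      SameEdge n (+ j - psum e k) (+ j - psum e (suc k)) (psum e k') (psum e (suc k')))

HasExactlyAxes : ℕ → List ℤ → ℕ → Set
HasExactlyAxes n e c =
  ∃ λ (js : List ℕ) → (length js ≡ c) × Unique js × All (ℕ._< n) js
    × All (IsAxis n e) js × (∀ j → j ℕ.< n → IsAxis n e j → j ∈ js)

RepresentsAxial : ℕ → List ℤ → Set
RepresentsAxial m e = Represents (3 ℕ.* m) e × HasExactlyAxes (3 ℕ.* m) e m

blockTuple : ℕ → ℤ → ℤ → List ℤ
blockTuple m a b = concat (replicate m (a ∷ b ∷ a ∷ []))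

{-# OPTIONS --safe #-}
-- The entries of a tuple representing an n-polygon add up to the final
-- partial sum, which must be divisible by n. The block tuple sums to
-- m(2a + b), so 3m ∣ m(2a + b) forces 3 ∣ 2a + b, i.e. a ≡ b (mod 3).
module Submission where

open import Defs
open import Data.Nat using (ℕ; suc; _<_)
open import Data.Nat.Properties using (≤-reflexive)
open import Data.Integer using (ℤ; +_; _-_; _+_; _*_)
open import Data.Integer.Divisibility using (_∣_; *-cancelʳ-∣)
import Data.Integer.Divisibility.Signed as Signed
open import Data.Integer.Properties using (pos-*; *-zeroʳ)
open import Data.Integer.Tactic.RingSolver using (solve-∀)
open import Data.List using (List; foldr)
open import Data.List.Properties using (take-all)
open import Data.Product using (_,_)
open import Relation.Nullary using (¬_)
open import Relation.Binary.PropositionalEquality using (_≡_; sym; cong; subst; subst₂; module ≡-Reasoning)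

sum : List ℤ → ℤ
sum = foldr _+_ (+ 0)

Represents⇒∣sum : ∀ {n e} → Represents n e → + n ∣ sum e
Represents⇒∣sum {n} {e} (length≡n , _ , _ , n∣psum) =
  subst (λ xs → + n ∣ sum xs) (take-all n e (≤-reflexive length≡n)) n∣psum

sum-blockTuple : ∀ m a b → sum (blockTuple m a b) ≡ (a + b + a) * + m
sum-blockTuple 0       a b = sym (*-zeroʳ (a + b + a))
sum-blockTuple (suc m) a b = begin
  a + (b + (a + sum (blockTuple m a b))) ≡⟨ cong (λ s → a + (b + (a + s))) (sum-blockTuple m a b) ⟩
  a + (b + (a + (a + b + a) * + m))      ≡⟨ one-more-block a b (+ m) ⟩
  (a + b + a) * (+ 1 + + m)              ∎
  where
  open ≡-Reasoning
  one-more-block : ∀ a b x → a + (b + (a + (a + b + a) * x)) ≡ (a + b + a) * (+ 1 + x)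
  one-more-block = solve-∀

3∣a+b+a⇒a≡[3]b : ∀ a b → + 3 ∣ a + b + a → a ≡[ 3 ] b
3∣a+b+a⇒a≡[3]b a b 3∣a+b+a =
  Signed.∣⇒∣ᵤ (subst (Signed._∣_ (+ 3)) (3a-[a+b+a]≡a-b a b)
    (Signed.∣m∣n⇒∣m-n (Signed.∣m⇒∣m*n a Signed.∣-refl) (Signed.∣ᵤ⇒∣ 3∣a+b+a)))
  where
  3a-[a+b+a]≡a-b : ∀ a b → + 3 * a - (a + b + a) ≡ a - b
  3a-[a+b+a]≡a-b = solve-∀

lemma3 : (m : ℕ) → 2 < m → (a b : ℤ) → ¬ ((+ 3) ∣ (a - b))
           → ¬ RepresentsAxial m (blockTuple m a b)
lemma3 m@(suc _) _ a b a≢b (represents , _) = a≢b (3∣a+b+a⇒a≡[3]b a b 3∣a+b+a)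
  where
  3m∣sum : + 3 * + m ∣ (a + b + a) * + m
  3m∣sum = subst₂ _∣_ (pos-* 3 m) (sum-blockTuple m a b) (Represents⇒∣sum represents)
  3∣a+b+a : + 3 ∣ a + b + a
  3∣a+b+a = *-cancelʳ-∣ (+ m) {+ 3} {a + b + a} 3m∣sum
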